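{- Every graph $G=(V,E)$ admits a maximum co-lex relation $\le_G$, i.e. a co-lex relation on $G$ containing every co-lex relation on $G$. Moreover, $\le_G$ is a co-lex preorder.
   Context: $\Sigma$ is a finite alphabet with a fixed total order $\preceq$. A graph is $G=(V,E)$ with $V$ finite and $E\subseteq V\times V\times\Sigma$. Let $\#\notin\Sigma$ with $\#\prec a$ for all $a\in\Sigma$. For $v\in V$, $\lambda(v)$ is the set of labels of edges entering $v$ if $v$ has incoming edges, and $\{\#\}$ otherwise. Write $\lambda(u)\,\angle\,\lambda(v)$ iff $a\preceq b$ for all $a\in\lambda(u)$, $b\in\lambda(v)$. A co-lex relation on $G$ is a reflexive $R\subseteq V\times V$ such that (Axiom 1) $u\neq v$, $(u,v)\in R$ implies $\lambda(u)\,\angle\,\lambda(v)$; (Axiom 2) for $(u',u,a),(v',v,a)\in E$ with $u\neq v$ and $(u,v)\in R$, $(u',v')\in R$. A co-lex preorder is a co-lex relation that is transitive. -}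

module Defs where

open import Data.Nat using (ℕ)
open import Data.Fin using (Fin)
open import Data.Fin.Properties using ()
open import Data.Maybe using (Maybe; just; nothing)
open import Data.Product using (_×_; _,_; Σ; ∃)
open import Data.List using (List)
open import Data.List.Membership.Propositional using (_∈_)
open import Relation.Binary.PropositionalEquality using (_≡_)
open import Relation.Nullary using (¬_)
import Data.Fin as F

-- The alphabet Σ is Fin σ, totally ordered by the usual order on Fin.
-- A graph on vertex set V = Fin n is a finite edge set E ⊆ V × V × Σ,
-- given as a list; (u , v , a) is an edge from u to v labelled a.
Graph : ℕ → ℕ → Set
Graph n σ = List (Fin n × Fin n × Fin σ)

-- Extended alphabet Σ ∪ {#}: nothing plays the role of #.
Label# : ℕ → Set
Label# σ = Maybe (Fin σ)

data _⪯#_ {σ : ℕ} : Label# σ → Label# σ → Set where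
  #⪯   : ∀ {x} → nothing ⪯# x
  a⪯b  : ∀ {a b} → a F.≤ b → just a ⪯# just b

data InLabels {n σ : ℕ} (G : Graph n σ) (v : Fin n) : Label# σ → Set where
  incoming : ∀ {u a} → (u , v , a) ∈ G → InLabels G v (just a)
  source   : (∀ u a → ¬ ((u , v , a) ∈ G)) → InLabels G v nothing

_∠_within_ : {n σ : ℕ} → Fin n → Fin n → Graph n σ → Set
u ∠ v within G = ∀ x y → InLabels G u x → InLabels G v y → x ⪯# y

Rel : ℕ → Set₁
Rel n = Fin n → Fin n → Set

Reflexive : {n : ℕ} → Rel n → Set
Reflexive R = ∀ v → R v v

Transitive : {n : ℕ} → Rel n → Set
Transitive R = ∀ {u v w} → R u v → R v w → R u w

record IsCoLex {n σ : ℕ} (G : Graph n σ) (R : Rel n) : Set where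
  field
    refl   : Reflexive R
    axiom1 : ∀ u v → ¬ (u ≡ v) → R u v → u ∠ v within G
    axiom2 : ∀ u' u v' v a → (u' , u , a) ∈ G → (v' , v , a) ∈ G →
             ¬ (u ≡ v) → R u v → R u' v'

record IsCoLexPreorder {n σ : ℕ} (G : Graph n σ) (R : Rel n) : Set where
  field
    colex : IsCoLex G R
    trans : Transitive R

_⊆R_ : {n : ℕ} → Rel n → Rel n → Set
R ⊆R S = ∀ u v → R u v → S u v

IsMaxCoLex : {n σ : ℕ} → Graph n σ → Rel n → Set₁
IsMaxCoLex G R = IsCoLex G R × (∀ (S : Rel _) → IsCoLex G S → S ⊆R R)

{-# OPTIONS --safe #-}
-- Call a pair (u , v) refuted if u ≢ v and either λ(u) ∠ λ(v) fails, or u and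
-- v have a-predecessors u' and v' with (u' , v') refuted. Axioms 1 and 2 say
-- precisely that a co-lex relation contains no refuted pair, and the relation
-- "not refuted" is itself co-lex, so it is the maximum one. Transitivity goes by
-- induction on refutations: if u ≤ v ≤ w are distinct and (u , w) is refuted by
-- a-predecessors u' and w', then λ(v) is squeezed between a and a, so v has an
-- a-predecessor v' and u' ≤ v' ≤ w' by Axiom 2.
module Submission where

open import Defs
open import Data.Nat using (ℕ)
open import Data.Product using (Σ; ∃; _×_; _,_)
open import Data.Fin using (Fin)
open import Data.Fin.Properties using (_≟_; _≤?_; ≤-trans; ≤-antisym)
open import Data.Maybe using (just; nothing)
open import Data.List.Relation.Unary.Any using (any?)
open import Data.List.Membership.Propositional using (_∈_; find; lose)
open import Relation.Nullary using (¬_; Dec; yes; no; contradiction)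
open import Relation.Binary.PropositionalEquality using (_≡_; refl)

⪯#-trans : ∀ {σ} {x y z : Label# σ} → x ⪯# y → y ⪯# z → x ⪯# z
⪯#-trans #⪯      _       = #⪯
⪯#-trans (a⪯b p) (a⪯b q) = a⪯b (≤-trans p q)

_⪯#?_ : ∀ {σ} (x y : Label# σ) → Dec (x ⪯# y)
nothing ⪯#? y       = yes #⪯
just a  ⪯#? nothing = no λ ()
just a  ⪯#? just b  with a ≤? b
... | yes a≤b = yes (a⪯b a≤b)
... | no  a≰b = no λ { (a⪯b a≤b) → a≰b a≤b }

module _ {n σ : ℕ} (G : Graph n σ) where

  target : Fin n × Fin n × Fin σ → Fin n
  target (_ , v , _) = v

  label-exists : ∀ v → ∃ (InLabels G v)
  label-exists v with any? (λ e → target e ≟ v) G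
  ... | yes has = edge-label (find has)
    where
    edge-label : ∃ (λ e → e ∈ G × target e ≡ v) → ∃ (InLabels G v)
    edge-label ((_ , _ , a) , e∈G , refl) = just a , incoming e∈G
  ... | no none = nothing , source (λ _ _ e∈G → none (lose e∈G refl))

  ∠-trans : ∀ {u v w} → u ∠ v within G → v ∠ w within G → u ∠ w within G
  ∠-trans {v = v} u∠v v∠w x y x∈λu y∈λw =
    let z , z∈λv = label-exists v in
    ⪯#-trans (u∠v x z x∈λu z∈λv) (v∠w z y z∈λv y∈λw)

  ∠-sandwich : ∀ {u v w u' w' a} → (u' , u , a) ∈ G → (w' , w , a) ∈ G →
               u ∠ v within G → v ∠ w within G → ∃ λ v' → (v' , v , a) ∈ G
  ∠-sandwich {v = v} e₁ e₂ u∠v v∠w with label-exists v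
  ... | just c , incoming {u = v'} e
    with u∠v _ _ (incoming e₁) (incoming e) | v∠w _ _ (incoming e) (incoming e₂)
  ...   | a⪯b a≤c | a⪯b c≤a with ≤-antisym a≤c c≤a
  ...     | refl = v' , e
  ∠-sandwich e₁ e₂ u∠v v∠w | nothing , source k with u∠v _ _ (incoming e₁) (source k)
  ... | ()

  data Refuted : Rel n where
    base : ∀ {u v x y} → ¬ u ≡ v → InLabels G u x → InLabels G v y → ¬ x ⪯# y →
           Refuted u v
    step : ∀ {u' u v' v a} → ¬ u ≡ v → (u' , u , a) ∈ G → (v' , v , a) ∈ G →
           Refuted u' v' → Refuted u v

  _≤G_ : Rel n
  u ≤G v = ¬ Refuted u v

  refuted⇒≢ : ∀ {u v} → Refuted u v → ¬ u ≡ v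
  refuted⇒≢ (base u≢v _ _ _) = u≢v
  refuted⇒≢ (step u≢v _ _ _) = u≢v

  ≤G⇒∠ : ∀ {u v} → ¬ u ≡ v → u ≤G v → u ∠ v within G
  ≤G⇒∠ u≢v u≤v x y x∈λu y∈λv with x ⪯#? y
  ... | yes x⪯y = x⪯y
  ... | no  x⋠y = contradiction (base u≢v x∈λu y∈λv x⋠y) u≤v

  ≤G-isCoLex : IsCoLex G _≤G_
  ≤G-isCoLex = record
    { refl   = λ v r → refuted⇒≢ r refl
    ; axiom1 = λ u v → ≤G⇒∠
    ; axiom2 = λ u' u v' v a e₁ e₂ u≢v u≤v r → u≤v (step u≢v e₁ e₂ r)
    }

  isCoLex⇒¬refuted : ∀ {S} → IsCoLex G S → ∀ {u v} → S u v → ¬ Refuted u v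
  isCoLex⇒¬refuted S-colex {u} {v} uSv (base u≢v x∈λu y∈λv x⋠y) =
    x⋠y (IsCoLex.axiom1 S-colex u v u≢v uSv _ _ x∈λu y∈λv)
  isCoLex⇒¬refuted S-colex {u} {v} uSv (step {u'} {_} {v'} {_} {a} u≢v e₁ e₂ r) =
    isCoLex⇒¬refuted S-colex (IsCoLex.axiom2 S-colex u' u v' v a e₁ e₂ u≢v uSv) r

  isCoLex⇒⊆≤G : ∀ S → IsCoLex G S → S ⊆R _≤G_
  isCoLex⇒⊆≤G S S-colex u v = isCoLex⇒¬refuted S-colex

  ≤G-trans : Transitive _≤G_
  ≤G-trans {u} {v} {w} u≤v v≤w r with u ≟ v | v ≟ w
  ... | yes refl | _        = v≤w r
  ... | no _     | yes refl = u≤v r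
  ... | no u≢v   | no v≢w   with r
  ...   | base _ x∈λu y∈λw x⋠y =
    x⋠y (∠-trans (≤G⇒∠ u≢v u≤v) (≤G⇒∠ v≢w v≤w) _ _ x∈λu y∈λw)
  ...   | step _ e₁ e₂ r' with ∠-sandwich e₁ e₂ (≤G⇒∠ u≢v u≤v) (≤G⇒∠ v≢w v≤w)
  ...     | v' , e = ≤G-trans (λ r″ → u≤v (step u≢v e₁ e r″)) (λ r″ → v≤w (step v≢w e e₂ r″)) r'

lemma4 : (n σ : ℕ) (G : Graph n σ) →
    Σ (Rel n) (λ R → IsMaxCoLex G R × IsCoLexPreorder G R)
lemma4 n σ G =
  _≤G_ G ,
  (≤G-isCoLex G , isCoLex⇒⊆≤G G) ,
  record { colex = ≤G-isCoLex G ; trans = ≤G-trans G }
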